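{- Let $(\mathcal{L},\models,\mathfrak{M})$ be a satisfaction system with finite $\mathcal{L}$ and let $\Phi_1,\ldots,\Phi_n\subseteq\mathcal{L}$ be non-trivial sets of statements. If there exists a set of statements $\Phi\subseteq\mathcal{L}$ that satisfies (P1), (P3) and (P4), then a middle ground exists for $\Phi_1,\ldots,\Phi_n$.
   Context: A satisfaction system is a triple $(\mathcal{L},\models,\mathfrak{M})$ where $\mathcal{L}$ is a language (a set of statements), $\mathfrak{M}$ a set of models and $\models\subseteq\mathfrak{M}\times\mathcal{L}$ a satisfaction relation. For $\Phi\subseteq\mathcal{L}$, $\pi\models\Phi$ iff $\pi\models\phi$ for all $\phi\in\Phi$; $\mathsf{mod}(\Phi)$ is the set of models $\pi\in\mathfrak{M}$ with $\pi\models\Phi$; $\Phi\models\Phi'$ iff every $\pi\in\mathfrak{M}$ with $\pi\models\Phi$ satisfies $\pi\models\Phi'$; $\Phi\equiv\Phi'$ iff $\Phi\models\Phi'$ and $\Phi'\models\Phi$. A statement $\phi$ is identified with $\{\phi\}$. $\Phi$ is consistent if $\mathsf{mod}(\Phi)\neq\emptyset$, falsifiable if $\mathsf{mod}(\Phi)\neq\mathfrak{M}$, and non-trivial if it is consistent and falsifiable. Given non-trivial sets $\Phi_1,\ldots,\Phi_n\subseteq\mathcal{L}$, the postulates for a set $\Phi\subseteq\mathcal{L}$ are: (P1) $\Phi$ is non-trivial; (P2) if $\bigcup_{i=1}^n\Phi_i$ is consistent then $\Phi\equiv\bigcup_{i=1}^n\Phi_i$; (P3) for each $\phi\in\Phi$,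 all $i\in\{1,\ldots,n\}$ and all $\phi_i\in\Phi_i$ there is $\pi\in\mathfrak{M}$ with $\pi\models\phi$ and $\pi\models\phi_i$; (P4) for each $\phi\in\Phi$ there is $i$ with $\Phi_i\models\phi$; (P5) there is no $\Phi'\subseteq\mathcal{L}$ with $\Phi'\models\Phi$, $\Phi\not\models\Phi'$ and $\Phi'$ satisfying (P1)–(P4). $\Phi$ is a middle ground for $\Phi_1,\ldots,\Phi_n$ if it satisfies (P1)–(P5). -}

module Defs where

open import Level using (Level; _⊔_) renaming (suc to lsuc)
open import Data.Nat using (ℕ)
open import Data.Fin using (Fin)
open import Data.Fin.Subset using (Subset; _∈_; ⁅_⁆; ⋃)
open import Data.List using (List; tabulate)
open import Data.Product using (Σ; ∃; _×_)
open import Relation.Nullary using (¬_)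

-- A finite language is represented as Fin size (statements are named
-- by the elements of Fin size); subsets of L are Data.Fin.Subset size.
record SatSystem (a ℓ : Level) : Set (lsuc (a ⊔ ℓ)) where
  field
    size    : ℕ
    Model   : Set a
    _⊨_     : Model → Fin size → Set ℓ

  Lang : Set
  Lang = Fin size

  StmtSet : Set
  StmtSet = Subset size

  _⊨ˢ_ : Model → StmtSet → Set ℓ
  π ⊨ˢ Φ = ∀ φ → φ ∈ Φ → π ⊨ φ

  _⊫_ : StmtSet → StmtSet → Set (a ⊔ ℓ)
  Φ ⊫ Ψ = ∀ π → π ⊨ˢ Φ → π ⊨ˢ Ψ

  _≋_ : StmtSet → StmtSet → Set (a ⊔ ℓ)
  Φ ≋ Ψ = (Φ ⊫ Ψ) × (Ψ ⊫ Φ)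

  Consistent : StmtSet → Set (a ⊔ ℓ)
  Consistent Φ = ∃ λ π → π ⊨ˢ Φ

  Falsifiable : StmtSet → Set (a ⊔ ℓ)
  Falsifiable Φ = ∃ λ π → ¬ (π ⊨ˢ Φ)

  NonTrivial : StmtSet → Set (a ⊔ ℓ)
  NonTrivial Φ = Consistent Φ × Falsifiable Φ

  module Postulates {n : ℕ} (Φs : Fin n → StmtSet) where

    ⋃Φs : StmtSet
    ⋃Φs = ⋃ (tabulate Φs)

    P1 : StmtSet → Set (a ⊔ ℓ)
    P1 Φ = NonTrivial Φ

    P2 : StmtSet → Set (a ⊔ ℓ)
    P2 Φ = Consistent ⋃Φs → Φ ≋ ⋃Φs

    P3 : StmtSet → Set (a ⊔ ℓ)
    P3 Φ = ∀ φ → φ ∈ Φ → ∀ i → ∀ φᵢ → φᵢ ∈ Φs i →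
           ∃ λ π → (π ⊨ φ) × (π ⊨ φᵢ)

    -- a statement φ is identified with the singleton {φ}
    P4 : StmtSet → Set (a ⊔ ℓ)
    P4 Φ = ∀ φ → φ ∈ Φ → ∃ λ i → Φs i ⊫ ⁅ φ ⁆

    P1-4 : StmtSet → Set (a ⊔ ℓ)
    P1-4 Φ = P1 Φ × P2 Φ × P3 Φ × P4 Φ

    P5 : StmtSet → Set (a ⊔ ℓ)
    P5 Φ = ¬ (∃ λ Φ' → (Φ' ⊫ Φ) × ¬ (Φ ⊫ Φ') × P1-4 Φ')

    MiddleGround : StmtSet → Set (a ⊔ ℓ)
    MiddleGround Φ = P1-4 Φ × P5 Φ

-- With excluded middle, let Cn Φ be the set of statements entailed by Φ. Strictly
-- strengthening Φ (Φ' ⊫ Φ but Φ ⊭ Φ') strictly enlarges Cn Φ, a subset of the finite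
-- language, so strict strengthening among the sets satisfying (P1)–(P4) is well founded
-- and every such set lies below a maximal one, which is a middle ground. A set satisfying
-- (P1)–(P4) exists: if ⋃ Φᵢ is consistent, ⋃ Φᵢ itself (it entails the given Φ by (P4),
-- hence inherits falsifiability); otherwise (P2) is vacuous and the given Φ will do.
module Submission where

open import Defs
open import Level using (Level; _⊔_)
open import Axiom.ExcludedMiddle using (ExcludedMiddle)
open import Data.Nat using (ℕ; zero; suc; _≤_; _<_; _∸_)
open import Data.Nat.Properties using (∸-monoʳ-<)
open import Data.Nat.Induction using (<-wellFounded)
open import Data.Fin using (Fin; zero; suc)
open import Data.Fin.Subset using (Subset; inside; _∈_; _⊆_; _⊂_; ⁅_⁆; ⋃; ∣_∣)
open import Data.Fin.Subset.Properties
  using (x∈⁅x⁆; x∈⁅y⁆⇒x≡y; ∉⊥; p⊆p∪q; q⊆p∪q; x∈p∪q⁻; p⊂q⇒∣p∣<∣q∣; ∣p∣≤n)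
open import Data.List using (tabulate)
import Data.Vec as Vec
open import Data.Vec.Properties using (lookup∘tabulate; []=⇒lookup; lookup⇒[]=)
open import Data.Product using (∃; _×_; _,_; proj₂)
open import Data.Sum using (inj₁; inj₂)
open import Data.Empty using (⊥-elim)
open import Function using (flip; _∘_)
open import Induction.WellFounded using (WellFounded; Acc; acc; module Subrelation)
open import Relation.Binary.Core using (Rel)
import Relation.Binary.Construct.On as On
open import Relation.Binary.PropositionalEquality using (_≡_; refl; sym; trans; subst)
open import Relation.Nullary using (¬_; yes; no; does)
open import Relation.Nullary.Decidable using (decidable-stable)
open import Relation.Unary using (Pred; Decidable)

⊆-⋃-tabulate : ∀ {m n} (ps : Fin n → Subset m) i → ps i ⊆ ⋃ (tabulate ps)
⊆-⋃-tabulate ps zero    = p⊆p∪q _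
⊆-⋃-tabulate ps (suc i) = q⊆p∪q (ps zero) _ ∘ ⊆-⋃-tabulate (ps ∘ suc) i

∈-⋃-tabulate⁻ : ∀ {m n} (ps : Fin n → Subset m) {x} →
                x ∈ ⋃ (tabulate ps) → ∃ λ i → x ∈ ps i
∈-⋃-tabulate⁻ {n = zero}  ps x∈ = ⊥-elim (∉⊥ x∈)
∈-⋃-tabulate⁻ {n = suc n} ps x∈ with x∈p∪q⁻ (ps zero) _ x∈
... | inj₁ x∈p = zero , x∈p
... | inj₂ x∈q with ∈-⋃-tabulate⁻ (ps ∘ suc) x∈q
...   | i , x∈pᵢ = suc i , x∈pᵢ

module _ {n p} {P : Pred (Fin n) p} (P? : Decidable P) where

  fromDec : Subset n
  fromDec = Vec.tabulate (does ∘ P?)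

  ∈-fromDec⁻ : ∀ {x} → x ∈ fromDec → P x
  ∈-fromDec⁻ {x} x∈ with P? x | trans (sym (lookup∘tabulate (does ∘ P?) x)) ([]=⇒lookup x∈)
  ... | yes Px | _ = Px
  ... | no  _  | ()

  ∈-fromDec⁺ : ∀ {x} → P x → x ∈ fromDec
  ∈-fromDec⁺ {x} Px = lookup⇒[]= x fromDec (trans (lookup∘tabulate (does ∘ P?) x) P?-yes)
    where
    P?-yes : does (P? x) ≡ inside
    P?-yes with P? x
    ... | yes _  = refl
    ... | no ¬Px = ⊥-elim (¬Px Px)

module _ {α r} {A : Set α} {_⋖_ : Rel A r} where

  ⋖-bounded-measure⇒flip-wellFounded : (μ : A → ℕ) {N : ℕ} → (∀ x → μ x ≤ N) →
    (∀ {x y} → x ⋖ y → μ x < μ y) → WellFounded (flip _⋖_)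
  ⋖-bounded-measure⇒flip-wellFounded μ {N} μ≤N ⋖⇒< =
    Subrelation.wellFounded (λ {x} {y} y⋖x → ∸-monoʳ-< (⋖⇒< y⋖x) (μ≤N x))
      (On.wellFounded (λ x → N ∸ μ x) <-wellFounded)

  ∃-⋖-maximal : ExcludedMiddle (α ⊔ r) → WellFounded (flip _⋖_) →
    ∀ {p} {P : Pred A p} → (∀ {x y} → x ⋖ y → P y) →
    ∀ {x} → P x → ∃ λ y → P y × ¬ ∃ (y ⋖_)
  ∃-⋖-maximal em wf {P = P} P-closed {x} Px = go (wf x) Px
    where
    go : ∀ {x} → Acc (flip _⋖_) x → P x → ∃ λ y → P y × ¬ ∃ (y ⋖_)
    go {x} (acc rs) Px with em {∃ (x ⋖_)}
    ... | no  maximal     = x , Px , maximal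
    ... | yes (y , x⋖y) = go (rs x⋖y) (P-closed x⋖y)

module Entailment {a ℓ : Level} (S : SatSystem a ℓ) where
  open SatSystem S

  ⊫-refl : ∀ {Φ} → Φ ⊫ Φ
  ⊫-refl π π⊨Φ = π⊨Φ

  ⊫-trans : ∀ {Φ Ψ Χ} → Φ ⊫ Ψ → Ψ ⊫ Χ → Φ ⊫ Χ
  ⊫-trans Φ⊫Ψ Ψ⊫Χ π = Ψ⊫Χ π ∘ Φ⊫Ψ π

  ⊆⇒⊫ : ∀ {Φ Ψ} → Ψ ⊆ Φ → Φ ⊫ Ψ
  ⊆⇒⊫ Ψ⊆Φ π π⊨Φ φ = π⊨Φ φ ∘ Ψ⊆Φ

  ∈⇒⊫⁅⁆ : ∀ {Φ φ} → φ ∈ Φ → Φ ⊫ ⁅ φ ⁆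
  ∈⇒⊫⁅⁆ {Φ} {φ} φ∈Φ = ⊆⇒⊫ λ ψ∈⁅φ⁆ → subst (_∈ Φ) (sym (x∈⁅y⁆⇒x≡y φ ψ∈⁅φ⁆)) φ∈Φ

  ⊫⁅⁆⇒⊫ : ∀ {Φ Ψ} → (∀ φ → φ ∈ Ψ → Φ ⊫ ⁅ φ ⁆) → Φ ⊫ Ψ
  ⊫⁅⁆⇒⊫ Φ⊫φ π π⊨Φ φ φ∈Ψ = Φ⊫φ φ φ∈Ψ π π⊨Φ φ (x∈⁅x⁆ φ)

  ⊫-falsifiable : ∀ {Φ Ψ} → Φ ⊫ Ψ → Falsifiable Ψ → Falsifiable Φ
  ⊫-falsifiable Φ⊫Ψ (π , π⊭Ψ) = π , π⊭Ψ ∘ Φ⊫Ψ π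

  module Consequences (em : ExcludedMiddle (a ⊔ ℓ)) where

    Cn : StmtSet → StmtSet
    Cn Φ = fromDec (λ φ → em {Φ ⊫ ⁅ φ ⁆})

    ∈-Cn⁺ : ∀ {Φ φ} → Φ ⊫ ⁅ φ ⁆ → φ ∈ Cn Φ
    ∈-Cn⁺ {Φ} = ∈-fromDec⁺ (λ φ → em {Φ ⊫ ⁅ φ ⁆})

    ∈-Cn⁻ : ∀ {Φ φ} → φ ∈ Cn Φ → Φ ⊫ ⁅ φ ⁆
    ∈-Cn⁻ {Φ} = ∈-fromDec⁻ (λ φ → em {Φ ⊫ ⁅ φ ⁆})

    Cn-⊂ : ∀ {Φ Φ'} → Φ' ⊫ Φ → ¬ (Φ ⊫ Φ') → Cn Φ ⊂ Cn Φ'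
    Cn-⊂ {Φ} {Φ'} Φ'⊫Φ Φ⊭Φ' = Cn-mono , witness
      where
      Cn-mono : Cn Φ ⊆ Cn Φ'
      Cn-mono φ∈ = ∈-Cn⁺ (⊫-trans Φ'⊫Φ (∈-Cn⁻ φ∈))
      witness : ∃ λ φ → φ ∈ Cn Φ' × ¬ (φ ∈ Cn Φ)
      witness with em {∃ λ φ → φ ∈ Φ' × ¬ (Φ ⊫ ⁅ φ ⁆)}
      ... | yes (φ , φ∈Φ' , Φ⊭φ) = φ , ∈-Cn⁺ (∈⇒⊫⁅⁆ φ∈Φ') , Φ⊭φ ∘ ∈-Cn⁻
      ... | no  none = ⊥-elim (Φ⊭Φ' (⊫⁅⁆⇒⊫ λ φ φ∈Φ' →
        decidable-stable em λ Φ⊭φ → none (φ , φ∈Φ' , Φ⊭φ)))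

  module _ {n : ℕ} (Φs : Fin n → StmtSet) where
    open Postulates Φs

    P4⇒⋃Φs⊫ : ∀ {Φ} → P4 Φ → ⋃Φs ⊫ Φ
    P4⇒⋃Φs⊫ P4-Φ = ⊫⁅⁆⇒⊫ λ φ φ∈Φ →
      let (i , Φsᵢ⊫φ) = P4-Φ φ φ∈Φ in ⊫-trans (⊆⇒⊫ (⊆-⋃-tabulate Φs i)) Φsᵢ⊫φ

    ⋃Φs-P1-4 : Consistent ⋃Φs → Falsifiable ⋃Φs → P1-4 ⋃Φs
    ⋃Φs-P1-4 (π , π⊨⋃Φs) falsifiable =
      ((π , π⊨⋃Φs) , falsifiable) , (λ _ → ⊫-refl , ⊫-refl) , P3-⋃Φs , P4-⋃Φs
      where
      P3-⋃Φs : P3 ⋃Φs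
      P3-⋃Φs φ φ∈ i φᵢ φᵢ∈Φsᵢ = π , π⊨⋃Φs φ φ∈ , π⊨⋃Φs φᵢ (⊆-⋃-tabulate Φs i φᵢ∈Φsᵢ)
      P4-⋃Φs : P4 ⋃Φs
      P4-⋃Φs φ φ∈ = let (i , φ∈Φsᵢ) = ∈-⋃-tabulate⁻ Φs φ∈ in i , ∈⇒⊫⁅⁆ φ∈Φsᵢ

    ∃-P1-4 : ExcludedMiddle (a ⊔ ℓ) → (∃ λ Φ → P1 Φ × P3 Φ × P4 Φ) → ∃ P1-4
    ∃-P1-4 em (Φ , (consistent , falsifiable) , P3-Φ , P4-Φ) with em {Consistent ⋃Φs}
    ... | yes ⋃Φs-consistent =
      ⋃Φs , ⋃Φs-P1-4 ⋃Φs-consistent (⊫-falsifiable (P4⇒⋃Φs⊫ P4-Φ) falsifiable)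
    ... | no  ⋃Φs-inconsistent =
      Φ , (consistent , falsifiable) , (⊥-elim ∘ ⋃Φs-inconsistent) , P3-Φ , P4-Φ

    -- P5 Φ is literally ¬ ∃ (Φ ≺_), so a ≺-maximal set satisfying (P1)–(P4) is a middle ground.
    _≺_ : Rel StmtSet (a ⊔ ℓ)
    Φ ≺ Φ' = (Φ' ⊫ Φ) × ¬ (Φ ⊫ Φ') × P1-4 Φ'

    ≺-flip-wellFounded : ExcludedMiddle (a ⊔ ℓ) → WellFounded (flip _≺_)
    ≺-flip-wellFounded em = ⋖-bounded-measure⇒flip-wellFounded (∣_∣ ∘ Cn) (∣p∣≤n ∘ Cn)
      λ (Φ'⊫Φ , Φ⊭Φ' , _) → p⊂q⇒∣p∣<∣q∣ (Cn-⊂ Φ'⊫Φ Φ⊭Φ')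
      where open Consequences em

proposition2 : {a ℓ : Level} → ExcludedMiddle (a ⊔ ℓ) →
    (S : SatSystem a ℓ) → let open SatSystem S in
    (n : ℕ) (Φs : Fin n → StmtSet) →
    (∀ i → NonTrivial (Φs i)) →
    let open Postulates Φs in
    (∃ λ Φ → P1 Φ × P3 Φ × P4 Φ) →
    ∃ λ Φ → MiddleGround Φ
proposition2 em S n Φs _ P1-3-4 =
  ∃-⋖-maximal em (≺-flip-wellFounded Φs em) (proj₂ ∘ proj₂) (proj₂ (∃-P1-4 Φs em P1-3-4))
  where open Entailment S
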